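{- Let $G=(U,V,E)$ be a complete bipartite graph with an edge labeling $\phi:E\to\{0,1\}$. For an integer $k\ge2$, call a sequence of vertices $(u_1,u_2,\dots,u_{2k})$ an alternating $2k$-cycle in $(G,\phi)$ if $u_1,u_3,\dots,u_{2k-1}\in U$, $u_2,u_4,\dots,u_{2k}\in V$, and $\phi(\{u_{2i-1},u_{2i}\})=0$ and $\phi(\{u_{2i},u_{2i+1}\})=1$ for all $i\in[k]$, where $u_{2k+1}:=u_1$. If $(G,\phi)$ has an alternating $2k$-cycle for some $k\ge 2$, then it has an alternating $4$-cycle. -}

module Defs where

open import Data.Nat using (ℕ; zero; suc; _≤_)
open import Data.Empty using (⊥)
open import Data.Bool using (Bool; true; false)
open import Data.Fin using (Fin; toℕ)
open import Data.Fin.Base using (fromℕ<)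
open import Data.Nat.DivMod using (_mod_)
open import Data.Product using (Σ; _×_; ∃-syntax)
open import Relation.Binary.PropositionalEquality using (_≡_)

-- A complete bipartite graph G = (U, V, E) with E = U × V; an edge labeling
-- φ : E → {0,1} is a function U → V → Bool (false = 0, true = 1).
Labeling : Set → Set → Set
Labeling U V = U → V → Bool

next : ∀ {m} → Fin (suc m) → Fin (suc m)
next {m} i = (suc (toℕ i)) mod (suc m)

-- An alternating 2k-cycle (u₁,…,u₂ₖ): odd positions uᵢ = us i ∈ U, even
-- positions vs i ∈ V (0-indexed i ∈ Fin k, with u_{2i+1} = us i, u_{2i+2} = vs i).
-- φ(u_{2i-1}, u_{2i}) = 0 and φ(u_{2i}, u_{2i+1}) = 1, with u_{2k+1} := u₁.
AltCycle : {U V : Set} → Labeling U V → (k : ℕ) → Set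
AltCycle φ zero = ⊥  -- k ≥ 2 is required anyway
AltCycle {U} {V} φ (suc m) =
  Σ (Fin (suc m) → U) λ us → Σ (Fin (suc m) → V) λ vs →
    ((i : Fin (suc m)) → φ (us i) (vs i) ≡ false) ×
    ((i : Fin (suc m)) → φ (us (next i)) (vs i) ≡ true)

-- Read the cycle as a closed alternating path u₀ v₀ u₁ v₁ … uₘ vₘ (closing
-- edge u₀vₘ labelled 1).  Look at the chord u₀v₁: if it is labelled 1, then
-- u₀ v₀ u₁ v₁ is an alternating 4-cycle; if it is labelled 0, it bypasses u₁
-- and v₀, leaving the shorter closed alternating path u₀ v₁ u₂ … vₘ.
module Submission where

open import Defs
open import Data.Bool using (false; true)
open import Data.Fin using (Fin; zero; suc; toℕ; fromℕ; inject₁)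
open import Data.Fin.Properties using (toℕ-fromℕ<; toℕ-injective; toℕ-inject₁; toℕ-fromℕ; toℕ<n)
open import Data.Nat using (ℕ; _≤_; _%_; s≤s)
open import Data.Nat.DivMod using (m<n⇒m%n≡m; n%n≡0)
open import Data.Product using (Σ; _×_; _,_; ∃₂)
open import Relation.Binary.PropositionalEquality using (_≡_; sym; trans; cong; subst; module ≡-Reasoning)

next-inject₁ : ∀ {m} (i : Fin m) → next (inject₁ i) ≡ suc i
next-inject₁ {m} i = toℕ-injective (begin
  toℕ (next (inject₁ i))            ≡⟨ toℕ-fromℕ< _ ⟩
  ℕ.suc (toℕ (inject₁ i)) % ℕ.suc m ≡⟨ cong (λ j → ℕ.suc j % ℕ.suc m) (toℕ-inject₁ i) ⟩
  ℕ.suc (toℕ i) % ℕ.suc m           ≡⟨ m<n⇒m%n≡m (s≤s (toℕ<n i)) ⟩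
  ℕ.suc (toℕ i)                     ∎)
  where open ≡-Reasoning

next-fromℕ : ∀ m → next (fromℕ m) ≡ zero
next-fromℕ m = toℕ-injective (begin
  toℕ (next (fromℕ m))            ≡⟨ toℕ-fromℕ< _ ⟩
  ℕ.suc (toℕ (fromℕ m)) % ℕ.suc m ≡⟨ cong (λ j → ℕ.suc j % ℕ.suc m) (toℕ-fromℕ m) ⟩
  ℕ.suc m % ℕ.suc m               ≡⟨ n%n≡0 (ℕ.suc m) ⟩
  0                               ∎)
  where open ≡-Reasoning

data AltPath {U V : Set} (φ : Labeling U V) : U → V → Set where
  [_]  : ∀ {u v} → φ u v ≡ false → AltPath φ u v
  step : ∀ {u v u′ w} → φ u v ≡ false → φ u′ v ≡ true → AltPath φ u′ w → AltPath φ u w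

ClosedAltPath : {U V : Set} → Labeling U V → Set
ClosedAltPath {U} {V} φ = ∃₂ λ (u : U) (w : V) → AltPath φ u w × φ u w ≡ true

module _ {U V : Set} {φ : Labeling U V} where

  altCycle₂ : ∀ {u u′ v v′} →
    φ u v ≡ false → φ u′ v ≡ true → φ u′ v′ ≡ false → φ u v′ ≡ true → AltCycle φ 2
  altCycle₂ {u} {u′} {v} {v′} uv u′v u′v′ uv′ = us , vs , zeros , ones
    where
    us : Fin 2 → U
    us zero       = u
    us (suc zero) = u′
    vs : Fin 2 → V
    vs zero       = v
    vs (suc zero) = v′
    zeros : ∀ i → φ (us i) (vs i) ≡ false
    zeros zero       = uv
    zeros (suc zero) = u′v′
    ones : ∀ i → φ (us (next i)) (vs i) ≡ true
    ones zero       = u′v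
    ones (suc zero) = uv′

  altPath-tabulate : ∀ {m} (us : Fin (ℕ.suc m) → U) (vs : Fin (ℕ.suc m) → V) →
    (∀ i → φ (us i) (vs i) ≡ false) →
    (∀ (i : Fin m) → φ (us (suc i)) (vs (inject₁ i)) ≡ true) →
    AltPath φ (us zero) (vs (fromℕ m))
  altPath-tabulate {ℕ.zero}  us vs zeros ones = [ zeros zero ]
  altPath-tabulate {ℕ.suc m} us vs zeros ones =
    step (zeros zero) (ones zero)
         (altPath-tabulate (λ i → us (suc i)) (λ i → vs (suc i)) (λ i → zeros (suc i)) (λ i → ones (suc i)))

  altCycle⇒closedAltPath : ∀ k → AltCycle φ k → ClosedAltPath φ
  altCycle⇒closedAltPath ℕ.zero ()
  altCycle⇒closedAltPath (ℕ.suc m) (us , vs , zeros , ones) =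
    us zero , vs (fromℕ m) , altPath-tabulate us vs zeros ones-inner , closing
    where
    ones-inner : ∀ (i : Fin m) → φ (us (suc i)) (vs (inject₁ i)) ≡ true
    ones-inner i = subst (λ j → φ (us j) (vs (inject₁ i)) ≡ true) (next-inject₁ i) (ones (inject₁ i))
    closing : φ (us zero) (vs (fromℕ m)) ≡ true
    closing = subst (λ j → φ (us j) (vs (fromℕ m)) ≡ true) (next-fromℕ m) (ones (fromℕ m))

  closedAltPath⇒altCycle₂ : ClosedAltPath φ → AltCycle φ 2
  closedAltPath⇒altCycle₂ (_ , _ , [ uw ] , uw′) with () ← trans (sym uw) uw′
  closedAltPath⇒altCycle₂ (_ , _ , step uv u′v p , uw) = shortcut uv u′v p uw
    where
    shortcut : ∀ {u v u′ w} →
      φ u v ≡ false → φ u′ v ≡ true → AltPath φ u′ w → φ u w ≡ true → AltCycle φ 2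
    shortcut uv u′v [ u′w ] uw = altCycle₂ uv u′v u′w uw
    shortcut {u} uv u′v (step {v = v′} u′v′ u″v′ p) uw with φ u v′ in uv′
    ... | true  = altCycle₂ uv u′v u′v′ uv′
    ... | false = shortcut uv′ u″v′ p uw

lemma4p22 : {U V : Set} (φ : Labeling U V) →
    Σ ℕ (λ k → (2 ≤ k) × AltCycle φ k) → AltCycle φ 2
lemma4p22 φ (k , _ , cycle) = closedAltPath⇒altCycle₂ (altCycle⇒closedAltPath k cycle)
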